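{- Let $\mathbf A,\mathbf B$ be finite algebras in $\mathcal V_3$ with $\mathbf A$ Jónsson trivial and simple, and let $\mathbf S$ be a subdirect subalgebra of $\mathbf A\times\mathbf B$. Then either $S=A\times B$, or $S$ is the graph of an onto homomorphism from $\mathbf B$ to $\mathbf A$ (i.e. $S=\{(h(b),b):b\in B\}$ for a surjective homomorphism $h:\mathbf B\to\mathbf A$).
   Context: $\mathcal V_3$ is the class of algebras $(A;p_0,p_1,p_2,p_3)$ with ternary basic operations satisfying $p_0(x,y,z)=x$, $p_3(x,y,z)=z$, $p_i(x,y,x)=x$ for all $i$, $p_0(x,x,y)=p_1(x,x,y)$, $p_2(x,x,y)=p_3(x,x,y)$, $p_1(x,y,y)=p_2(x,y,y)$; $x\cdot y=p_1(x,y,y)$. A Jónsson ideal of $\mathbf A$ is a subuniverse $Y$ with $u\cdot y\in Y$ for all $y\in Y,u\in A$; a finite $\mathbf A\in\mathcal V_3$ is Jónsson trivial if its only Jónsson ideals are $\emptyset$ and $A$. Simple means the only congruences are $0_A$ and $A^2$. Subdirect means both projections of $S$ are onto. -}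

module Defs where

open import Data.Nat using (ℕ)
open import Data.Fin using (Fin)
open import Data.Product using (Σ; ∃; _×_; _,_; proj₁; proj₂)
open import Data.Sum using (_⊎_)
open import Data.Empty using (⊥)
open import Relation.Nullary using (¬_)
open import Relation.Binary.PropositionalEquality using (_≡_)
open import Function.Bundles using (_↔_; _⇔_)
open import Function.Definitions using (Surjective)

record V3 : Set₁ where
  field
    Carrier : Set
    p₀ p₁ p₂ p₃ : Carrier → Carrier → Carrier → Carrier
    p₀-proj : ∀ x y z → p₀ x y z ≡ x
    p₃-proj : ∀ x y z → p₃ x y z ≡ z
    p₀-idem : ∀ x y → p₀ x y x ≡ x
    p₁-idem : ∀ x y → p₁ x y x ≡ x
    p₂-idem : ∀ x y → p₂ x y x ≡ x
    p₃-idem : ∀ x y → p₃ x y x ≡ x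
    p₀p₁ : ∀ x y → p₀ x x y ≡ p₁ x x y
    p₂p₃ : ∀ x y → p₂ x x y ≡ p₃ x x y
    p₁p₂ : ∀ x y → p₁ x y y ≡ p₂ x y y

  _·_ : Carrier → Carrier → Carrier
  x · y = p₁ x y y

open V3 public

Finite : V3 → Set
Finite A = ∃ λ n → Carrier A ↔ Fin n

Subset : V3 → Set₁
Subset A = Carrier A → Set

IsSubuniverse : (A : V3) → Subset A → Set
IsSubuniverse A Y =
  (∀ x y z → Y x → Y y → Y z → Y (p₀ A x y z)) ×
  (∀ x y z → Y x → Y y → Y z → Y (p₁ A x y z)) ×
  (∀ x y z → Y x → Y y → Y z → Y (p₂ A x y z)) ×
  (∀ x y z → Y x → Y y → Y z → Y (p₃ A x y z))

IsJonssonIdeal : (A : V3) → Subset A → Set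
IsJonssonIdeal A Y = IsSubuniverse A Y × (∀ u y → Y y → Y (_·_ A u y))

JonssonTrivial : V3 → Set₁
JonssonTrivial A = (Y : Subset A) → IsJonssonIdeal A Y →
  (∀ a → ¬ Y a) ⊎ (∀ a → Y a)

Compatible : (A : V3) → (Carrier A → Carrier A → Set) →
             (Carrier A → Carrier A → Carrier A → Carrier A) → Set
Compatible A R f = ∀ x y z x' y' z' → R x x' → R y y' → R z z' →
  R (f x y z) (f x' y' z')

IsCongruence : (A : V3) → (Carrier A → Carrier A → Set) → Set
IsCongruence A R =
  (∀ x → R x x) × (∀ x y → R x y → R y x) × (∀ x y z → R x y → R y z → R x z) ×
  Compatible A R (p₀ A) × Compatible A R (p₁ A) ×
  Compatible A R (p₂ A) × Compatible A R (p₃ A)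

Simple : V3 → Set₁
Simple A = (R : Carrier A → Carrier A → Set) → IsCongruence A R →
  (∀ x y → R x y → x ≡ y) ⊎ (∀ x y → R x y)

IsHom : (B A : V3) → (Carrier B → Carrier A) → Set
IsHom B A h =
  (∀ x y z → h (p₀ B x y z) ≡ p₀ A (h x) (h y) (h z)) ×
  (∀ x y z → h (p₁ B x y z) ≡ p₁ A (h x) (h y) (h z)) ×
  (∀ x y z → h (p₂ B x y z) ≡ p₂ A (h x) (h y) (h z)) ×
  (∀ x y z → h (p₃ B x y z) ≡ p₃ A (h x) (h y) (h z))

Rel2 : V3 → V3 → Set₁
Rel2 A B = Carrier A → Carrier B → Set

IsSubalgebraProd : (A B : V3) → Rel2 A B → Set
IsSubalgebraProd A B S =
  (∀ a₁ a₂ a₃ b₁ b₂ b₃ → S a₁ b₁ → S a₂ b₂ → S a₃ b₃ → S (p₀ A a₁ a₂ a₃) (p₀ B b₁ b₂ b₃)) ×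
  (∀ a₁ a₂ a₃ b₁ b₂ b₃ → S a₁ b₁ → S a₂ b₂ → S a₃ b₃ → S (p₁ A a₁ a₂ a₃) (p₁ B b₁ b₂ b₃)) ×
  (∀ a₁ a₂ a₃ b₁ b₂ b₃ → S a₁ b₁ → S a₂ b₂ → S a₃ b₃ → S (p₂ A a₁ a₂ a₃) (p₂ B b₁ b₂ b₃)) ×
  (∀ a₁ a₂ a₃ b₁ b₂ b₃ → S a₁ b₁ → S a₂ b₂ → S a₃ b₃ → S (p₃ A a₁ a₂ a₃) (p₃ B b₁ b₂ b₃))

IsSubdirect : (A B : V3) → Rel2 A B → Set
IsSubdirect A B S = (∀ a → ∃ λ b → S a b) × (∀ b → ∃ λ a → S a b)

-- Call a, a′ ∈ A linked when S relates both to a common b. The transitive closure of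
-- linkage is a congruence of A, so by simplicity it is either trivial or total. If it is
-- trivial, S is the graph of a map B → A, which is an onto homomorphism because S is a
-- subdirect subalgebra. If it is total, the key fact is that for a subalgebra R ≤ A × C,
-- onto C, in which any two elements of A are linked, each fibre {a : R a c} is a Jónsson
-- ideal, so R = A × C when A is Jónsson trivial. By finiteness some 2^M linkage steps
-- join any two elements; the fact applied to "joined by 2^m steps" halves the number of
-- steps repeatedly down to one, and a last application gives S = A × B.
module Submission where

open import Defs
open import Data.Nat using (ℕ; zero; suc; _≤_; _≤′_; ≤′-refl; ≤′-step; _⊔_)
open import Data.Nat.Properties using (≤⇒≤′; ≤-trans; m≤m⊔n; m≤n⊔m)
open import Data.Fin using (Fin)
import Data.Fin as Fin
open import Data.Product using (Σ; ∃; _×_; _,_; proj₁; proj₂)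
open import Data.Sum using (_⊎_; inj₁; inj₂)
open import Data.Empty using (⊥-elim)
open import Function using (case_of_)
open import Function.Bundles using (_↔_; _⇔_; mk⇔; Inverse)
open import Function.Definitions using (Surjective)
open import Relation.Binary.PropositionalEquality using (_≡_; refl; sym; trans; subst; subst₂)

uniform-bound-Fin : ∀ n (P : Fin n → ℕ → Set) → (∀ i {m m′} → m ≤ m′ → P i m → P i m′) →
                    (∀ i → ∃ (P i)) → ∃ λ M → ∀ i → P i M
uniform-bound-Fin zero P mono eventually = 0 , λ ()
uniform-bound-Fin (suc n) P mono eventually
  with eventually Fin.zero
     | uniform-bound-Fin n (λ i → P (Fin.suc i)) (λ i → mono (Fin.suc i)) (λ i → eventually (Fin.suc i))
... | m₀ , at-zero | M , at-suc =
  m₀ ⊔ M , λ { Fin.zero → mono Fin.zero (m≤m⊔n m₀ M) at-zero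
             ; (Fin.suc i) → mono (Fin.suc i) (m≤n⊔m m₀ M) (at-suc i) }

uniform-bound : {X : Set} {n : ℕ} → X ↔ Fin n → (P : X → ℕ → Set) →
                (∀ x {m m′} → m ≤ m′ → P x m → P x m′) →
                (∀ x → ∃ (P x)) → ∃ λ M → ∀ x → P x M
uniform-bound {n = n} X↔Fin P mono eventually =
  let M , uniform = uniform-bound-Fin n (λ i → P (from i)) (λ i → mono (from i)) (λ i → eventually (from i))
  in M , λ x → subst (λ x′ → P x′ M) (strictlyInverseʳ x) (uniform (to x))
  where open Inverse X↔Fin

Preserves : {X Y : Set} → (X → Y → Set) → (X → X → X → X) → (Y → Y → Y → Y) → Set
Preserves R f g = ∀ x₁ x₂ x₃ y₁ y₂ y₃ → R x₁ y₁ → R x₂ y₂ → R x₃ y₃ → R (f x₁ x₂ x₃) (g y₁ y₂ y₃)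

Linked : {X Y : Set} → (X → Y → Set) → X → X → Set
Linked R x x′ = ∃ λ y → R x y × R x′ y

Linked-preserves : {X Y : Set} {R : X → Y → Set} {f : X → X → X → X} {g : Y → Y → Y → Y} →
                   Preserves R f g → Preserves (Linked R) f f
Linked-preserves {g = g} pres _ _ _ _ _ _ (y₁ , r₁ , r₁′) (y₂ , r₂ , r₂′) (y₃ , r₃ , r₃′) =
  g y₁ y₂ y₃ , pres _ _ _ _ _ _ r₁ r₂ r₃ , pres _ _ _ _ _ _ r₁′ r₂′ r₃′

module _ (A C : V3) (R : Rel2 A C) (R-sub : IsSubalgebraProd A C R)
         (linked : ∀ u w → Linked R u w) where

  fibre-closed : ∀ {f g} → Preserves R f g → (∀ c → g c c c ≡ c) →
                 ∀ c x y z → R x c → R y c → R z c → R (f x y z) c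
  fibre-closed pres idem c x y z rx ry rz = subst (R _) (idem c) (pres _ _ _ _ _ _ rx ry rz)

  -- u · w = p₂(u,w,w) is R-related to p₂(c′,c′,c) = p₃(c′,c′,c) = c, where c′ links u and w.
  fibre-absorbs : ∀ c u w → R w c → R (_·_ A u w) c
  fibre-absorbs c u w rw =
    let c′ , ru′ , rw′ = linked u w
    in subst₂ R (sym (p₁p₂ A u w)) (trans (p₂p₃ C c′ c) (p₃-proj C c′ c′ c))
         (proj₁ (proj₂ (proj₂ R-sub)) _ _ _ _ _ _ ru′ rw′ rw)

  fibre-isJonssonIdeal : ∀ c → IsJonssonIdeal A (λ a → R a c)
  fibre-isJonssonIdeal c =
    ( fibre-closed (proj₁ R-sub) (λ c → p₀-idem C c c) c
    , fibre-closed (proj₁ (proj₂ R-sub)) (λ c → p₁-idem C c c) c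
    , fibre-closed (proj₁ (proj₂ (proj₂ R-sub))) (λ c → p₂-idem C c c) c
    , fibre-closed (proj₂ (proj₂ (proj₂ R-sub))) (λ c → p₃-idem C c c) c )
    , fibre-absorbs c

  total-of-linked : JonssonTrivial A → (∀ c → ∃ λ a → R a c) → ∀ a c → R a c
  total-of-linked jt inhabited a c with jt (λ a → R a c) (fibre-isJonssonIdeal c)
  ... | inj₁ empty = ⊥-elim (empty _ (proj₂ (inhabited c)))
  ... | inj₂ full  = full a

-- Chain m relates x and y when they are joined by a path of 2^m steps of Linked S,
-- so that Connected, the union of the Chain m, is the transitive closure of Linked S.
module Linkage (A B : V3) (S : Rel2 A B) (S-sub : IsSubalgebraProd A B S) (S-sd : IsSubdirect A B S) where

  Chain : ℕ → Rel2 A A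
  Chain zero = Linked S
  Chain (suc m) x y = ∃ λ z → Chain m x z × Chain m z y

  Chain-refl : ∀ m x → Chain m x x
  Chain-refl zero x = let b , s = proj₁ S-sd x in b , s , s
  Chain-refl (suc m) x = x , Chain-refl m x , Chain-refl m x

  Chain-sym : ∀ m {x y} → Chain m x y → Chain m y x
  Chain-sym zero (b , s , s′) = b , s′ , s
  Chain-sym (suc m) (z , q , q′) = z , Chain-sym m q′ , Chain-sym m q

  Chain-preserves : ∀ m {f g} → Preserves S f g → Preserves (Chain m) f f
  Chain-preserves zero pres = Linked-preserves pres
  Chain-preserves (suc m) {f} pres _ _ _ _ _ _ (z₁ , q₁ , q₁′) (z₂ , q₂ , q₂′) (z₃ , q₃ , q₃′) =
    f z₁ z₂ z₃ , Chain-preserves m pres _ _ _ _ _ _ q₁ q₂ q₃ , Chain-preserves m pres _ _ _ _ _ _ q₁′ q₂′ q₃′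

  Chain-isSubalgebra : ∀ m → IsSubalgebraProd A A (Chain m)
  Chain-isSubalgebra m =
    ( Chain-preserves m (proj₁ S-sub)
    , Chain-preserves m (proj₁ (proj₂ S-sub))
    , Chain-preserves m (proj₁ (proj₂ (proj₂ S-sub)))
    , Chain-preserves m (proj₂ (proj₂ (proj₂ S-sub))) )

  Chain-mono′ : ∀ {m m′} → m ≤′ m′ → ∀ {x y} → Chain m x y → Chain m′ x y
  Chain-mono′ ≤′-refl q = q
  Chain-mono′ (≤′-step {n} m≤′n) {y = y} q = y , Chain-mono′ m≤′n q , Chain-refl n y

  Chain-mono : ∀ {m m′} → m ≤ m′ → ∀ {x y} → Chain m x y → Chain m′ x y
  Chain-mono m≤m′ = Chain-mono′ (≤⇒≤′ m≤m′)

  Connected : Carrier A → Carrier A → Set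
  Connected x y = ∃ λ m → Chain m x y

  Connected-compatible : ∀ {f g} → Preserves S f g → Compatible A Connected f
  Connected-compatible {f} pres _ _ _ _ _ _ (m₁ , q₁) (m₂ , q₂) (m₃ , q₃) =
    m₁ ⊔ m₂ ⊔ m₃ ,
    Chain-preserves (m₁ ⊔ m₂ ⊔ m₃) pres _ _ _ _ _ _
      (Chain-mono (≤-trans (m≤m⊔n m₁ m₂) (m≤m⊔n (m₁ ⊔ m₂) m₃)) q₁)
      (Chain-mono (≤-trans (m≤n⊔m m₁ m₂) (m≤m⊔n (m₁ ⊔ m₂) m₃)) q₂)
      (Chain-mono (m≤n⊔m (m₁ ⊔ m₂) m₃) q₃)

  Connected-isCongruence : IsCongruence A Connected
  Connected-isCongruence =
    (λ x → 0 , Chain-refl 0 x) ,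
    (λ _ _ (m , q) → m , Chain-sym m q) ,
    (λ _ y _ (m₁ , q₁) (m₂ , q₂) →
      suc (m₁ ⊔ m₂) , y , Chain-mono (m≤m⊔n m₁ m₂) q₁ , Chain-mono (m≤n⊔m m₁ m₂) q₂) ,
    Connected-compatible (proj₁ S-sub) ,
    Connected-compatible (proj₁ (proj₂ S-sub)) ,
    Connected-compatible (proj₁ (proj₂ (proj₂ S-sub))) ,
    Connected-compatible (proj₂ (proj₂ (proj₂ S-sub)))

  Chain-uniform : Finite A → (∀ x y → Connected x y) → ∃ λ M → ∀ x y → Chain M x y
  Chain-uniform (n , A↔Fin) connected =
    uniform-bound A↔Fin (λ x m → ∀ y → Chain m x y) (λ _ m≤m′ chains y → Chain-mono m≤m′ (chains y))
      (λ x → uniform-bound A↔Fin (λ y m → Chain m x y) (λ _ m≤m′ → Chain-mono m≤m′) (connected x))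

  module _ (jt : JonssonTrivial A) where

    -- Totality of Chain (suc m) says any two elements are Chain m-linked through a midpoint.
    Chain-total-pred : ∀ m → (∀ x y → Chain (suc m) x y) → ∀ x y → Chain m x y
    Chain-total-pred m total =
      total-of-linked A A (Chain m) (Chain-isSubalgebra m)
        (λ u w → let v , q , q′ = total u w in v , q , Chain-sym m q′)
        jt (λ x → x , Chain-refl m x)

    Chain-total-zero : ∀ m → (∀ x y → Chain m x y) → ∀ x y → Chain zero x y
    Chain-total-zero zero total = total
    Chain-total-zero (suc m) total = Chain-total-zero m (Chain-total-pred m total)

    total-of-connected : Finite A → (∀ x y → Connected x y) → ∀ a b → S a b
    total-of-connected finA connected =
      let M , total = Chain-uniform finA connected
      in total-of-linked A B S S-sub (Chain-total-zero M total) jt (proj₂ S-sd)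

module _ (A B : V3) (S : Rel2 A B) (S-sub : IsSubalgebraProd A B S) (S-sd : IsSubdirect A B S)
         (functional : ∀ {a a′ b} → S a b → S a′ b → a ≡ a′) where

  partner : Carrier B → Carrier A
  partner b = proj₁ (proj₂ S-sd b)

  partner-related : ∀ b → S (partner b) b
  partner-related b = proj₂ (proj₂ S-sd b)

  partner-preserves : ∀ {f g} → Preserves S f g →
                      ∀ x y z → partner (g x y z) ≡ f (partner x) (partner y) (partner z)
  partner-preserves pres x y z =
    functional (partner-related _) (pres _ _ _ _ _ _ (partner-related x) (partner-related y) (partner-related z))

  partner-isHom : IsHom B A partner
  partner-isHom =
    partner-preserves (proj₁ S-sub) ,
    partner-preserves (proj₁ (proj₂ S-sub)) ,
    partner-preserves (proj₁ (proj₂ (proj₂ S-sub))) ,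
    partner-preserves (proj₂ (proj₂ (proj₂ S-sub)))

  partner-surjective : Surjective _≡_ _≡_ partner
  partner-surjective a = let b , s = proj₁ S-sd a in b , λ { refl → functional (partner-related b) s }

  related⇔partner : ∀ a b → S a b ⇔ (a ≡ partner b)
  related⇔partner a b = mk⇔ (λ s → functional s (partner-related b)) (λ { refl → partner-related b })

  graph-of-functional : Σ (Carrier B → Carrier A) λ h →
                          IsHom B A h × Surjective _≡_ _≡_ h × (∀ a b → S a b ⇔ (a ≡ h b))
  graph-of-functional = partner , partner-isHom , partner-surjective , related⇔partner

lemma3p8 : (A B : V3) → Finite A → Finite B → JonssonTrivial A → Simple A →
    (S : Rel2 A B) → IsSubalgebraProd A B S → IsSubdirect A B S →
    (∀ a b → S a b)
    ⊎ Σ (Carrier B → Carrier A) (λ h →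
        IsHom B A h × Surjective _≡_ _≡_ h × (∀ a b → S a b ⇔ (a ≡ h b)))
lemma3p8 A B finA _ jt simple S S-sub S-sd = case simple Connected Connected-isCongruence of λ where
    (inj₂ connected) → inj₁ (total-of-connected jt finA connected)
    (inj₁ discrete) → inj₂ (graph-of-functional A B S S-sub S-sd λ s s′ → discrete _ _ (0 , _ , s , s′))
  where open Linkage A B S S-sub S-sd
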